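{- $({\cal C},X)$ has a satisfying truth assignment if and only if $G'$ has a $5$-colouring.
   Context: Let $({\cal C},X)$ be an instance of Not-All-Equal 3-Satisfiability with positive literals only (variables $X=\{x_1,\ldots,x_n\}$, clauses ${\cal C}=\{C_1,\ldots,C_m\}$ of three positive literals; satisfying means each clause has a true and a false literal). Build graph $G$ with lists $L$: adjacent vertices $x_i,\overline{x}_i$ with lists $\{4,5\}$ for each variable; vertices $C_j,C_j'$ with lists $\{1,2,3\}$ for each clause; all edges between $\{x_i,\overline{x}_i\}$-vertices and $\{C_j,C_j'\}$-vertices; for each clause $C_j=\{x_g,x_h,x_i\}$ (fixed order) vertices $a_{g,j},a_{h,j},a_{i,j},a_{g,j}',a_{h,j}',a_{i,j}'$ with paths $x_g-a_{g,j}-C_j$, $x_h-a_{h,j}-C_j$, $x_i-a_{i,j}-C_j$, $\overline{x}_g-a_{g,j}'-C_j'$, $\overline{x}_h-a_{h,j}'-C_j'$, $\overline{x}_i-a_{i,j}'-C_j'$ and lists $\{1,4\}$ for $a_{g,j},a_{g,j}'$, $\{2,4\}$ for $a_{h,j},a_{h,j}'$, $\{3,4\}$ for $a_{i,j},a_{i,j}'$. Then $G'$ is obtained from $G$ by adding a clique on five new vertices $k_1,\ldots,k_5$ and an edge between $k_\ell$ and $u\in V(G)$ if and only if $\ell\notin L(u)$. -}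

module Defs where

open import Data.Nat using (ℕ)
open import Data.Fin using (Fin; zero; suc)
open import Data.Bool using (Bool; true; false)
open import Data.List using (List; []; _∷_)
open import Data.List.Membership.Propositional using (_∈_)
open import Data.Product using (Σ; ∃; _×_; _,_)
open import Data.Sum using (_⊎_)
open import Relation.Binary.PropositionalEquality using (_≡_; _≢_)
open import Relation.Nullary using (¬_)

-- An instance (C , X) of positive Not-All-Equal 3-SAT with variables
-- x_0 .. x_{n-1} (Fin n) and clauses C_0 .. C_{m-1} (Fin m).
-- Clause j is given in its fixed order (g , h , i) as  cl j 0 , cl j 1 , cl j 2.
Instance : ℕ → ℕ → Set
Instance n m = Fin m → Fin 3 → Fin n

ProperInstance : ∀ {n m} → Instance n m → Set
ProperInstance {n} {m} cl = ∀ (j : Fin m) (p q : Fin 3) → cl j p ≡ cl j q → p ≡ q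

NAESatisfies : ∀ {n m} → Instance n m → (Fin n → Bool) → Set
NAESatisfies {n} {m} cl τ =
  ∀ (j : Fin m) → (∃ λ p → τ (cl j p) ≡ true) × (∃ λ q → τ (cl j q) ≡ false)

NAESatisfiable : ∀ {n m} → Instance n m → Set
NAESatisfiable {n} cl = Σ (Fin n → Bool) (NAESatisfies cl)

-- Colours 1,...,5 are represented by Fin 5: colour k is the element with toℕ = k - 1.
col1 col2 col3 col4 col5 : Fin 5
col1 = zero
col2 = suc zero
col3 = suc (suc zero)
col4 = suc (suc (suc zero))
col5 = suc (suc (suc (suc zero)))

-- Vertices of G.  a j p  is  a_{v,j}  where v = cl j p (the p-th variable of C_j),
-- a' j p is a'_{v,j}.
data VG (n m : ℕ) : Set where
  x  : Fin n → VG n m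
  x̄  : Fin n → VG n m
  c  : Fin m → VG n m
  c' : Fin m → VG n m
  a  : Fin m → Fin 3 → VG n m
  a' : Fin m → Fin 3 → VG n m

-- The colour of position p in a clause: 1 for g, 2 for h, 3 for i.
posCol : Fin 3 → Fin 5
posCol zero = col1
posCol (suc zero) = col2
posCol (suc (suc zero)) = col3

L : ∀ {n m} → VG n m → List (Fin 5)
L (x i)    = col4 ∷ col5 ∷ []
L (x̄ i)    = col4 ∷ col5 ∷ []
L (c j)    = col1 ∷ col2 ∷ col3 ∷ []
L (c' j)   = col1 ∷ col2 ∷ col3 ∷ []
L (a j p)  = posCol p ∷ col4 ∷ []
L (a' j p) = posCol p ∷ col4 ∷ []

-- (Directed representation of) the edges of G.
data EdgeG {n m : ℕ} (cl : Instance n m) : VG n m → VG n m → Set where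
  xx̄   : ∀ i → EdgeG cl (x i) (x̄ i)
  x-c  : ∀ i j → EdgeG cl (x i) (c j)
  x-c' : ∀ i j → EdgeG cl (x i) (c' j)
  x̄-c  : ∀ i j → EdgeG cl (x̄ i) (c j)
  x̄-c' : ∀ i j → EdgeG cl (x̄ i) (c' j)
  x-a  : ∀ j p → EdgeG cl (x (cl j p)) (a j p)
  a-c  : ∀ j p → EdgeG cl (a j p) (c j)
  x̄-a' : ∀ j p → EdgeG cl (x̄ (cl j p)) (a' j p)
  a'-c' : ∀ j p → EdgeG cl (a' j p) (c' j)

-- Vertices of G': those of G plus k_1..k_5 (k ℓ for ℓ : Fin 5, i.e. k_{ℓ+1}).
data V' (n m : ℕ) : Set where
  g : VG n m → V' n m
  k : Fin 5 → V' n m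

data EdgeG' {n m : ℕ} (cl : Instance n m) : V' n m → V' n m → Set where
  old    : ∀ {u v} → EdgeG cl u v → EdgeG' cl (g u) (g v)
  clique : ∀ ℓ ℓ' → ℓ ≢ ℓ' → EdgeG' cl (k ℓ) (k ℓ')
  k-u    : ∀ ℓ u → ¬ (ℓ ∈ L u) → EdgeG' cl (k ℓ) (g u)

Adj' : ∀ {n m} → Instance n m → V' n m → V' n m → Set
Adj' cl u v = EdgeG' cl u v ⊎ EdgeG' cl v u

FiveColourable : ∀ {n m} → Instance n m → Set
FiveColourable {n} {m} cl =
  Σ (V' n m → Fin 5) λ col → ∀ u v → Adj' cl u v → col u ≢ col v

-- The proof passes through list colourings of G (colour every vertex u from
-- its list L u so that adjacent vertices get different colours), in two
-- independent steps.
--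
--  * Clique gadget.  G' is 5-colourable iff G is L-colourable.  An
--    L-colouring extends to G' by giving k_ℓ the colour ℓ.  Conversely the
--    clique k_1..k_5 uses each colour exactly once (an injective self-map of a
--    finite set is surjective), so renaming colours after the clique turns a
--    5-colouring of G' into an L-colouring of G: the colour of k_ℓ is
--    forbidden on u exactly when ℓ ∉ L u.
--
--  * Clause gadget.  G is L-colourable iff the instance is NAE-satisfiable.
--    Colour x_i with 4 when x_i is true and x̄_i with 4 otherwise.  A clause
--    vertex C_j (resp. C'_j) can be coloured iff some a-vertex (resp. a'-vertex)
--    of C_j is coloured 4, i.e. iff some literal of C_j is false (resp. true).
module Submission where

open import Defs
open import Data.Nat using (ℕ)
open import Data.Nat.Properties using (n<1+n)
open import Data.Fin using (Fin; zero; suc; _≟_)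
open import Data.Fin.Properties using (pigeonhole; <⇒≢; ¬∀⟶∃¬)
open import Data.Bool using (Bool; true; false; if_then_else_)
open import Data.List using ([]; _∷_)
open import Data.List.Relation.Unary.Any using (here; there)
open import Data.List.Membership.Propositional using (_∈_)
open import Data.List.Membership.DecPropositional (_≟_ {5}) using (_∈?_)
open import Data.Vec.Functional using () renaming (_∷_ to _◂_)
open import Data.Product using (Σ; ∃; _×_; _,_; proj₁; proj₂)
open import Data.Sum using (inj₁; inj₂)
open import Function.Base using (_∘_)
open import Function.Bundles using (_⇔_; mk⇔)
open import Function.Definitions using (Injective)
open import Relation.Binary.PropositionalEquality using (_≡_; _≢_; refl; sym; trans; cong; subst)
open import Relation.Nullary using (¬_; yes; no; does; contradiction)
open import Relation.Nullary.Decidable using (dec-true; dec-false)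

-- An injective self-map of Fin d is onto: were a colour missed, prepending it to π
-- would give a map Fin (d + 1) → Fin d without a collision.
injective⇒onto : ∀ {d} (π : Fin d → Fin d) → Injective _≡_ _≡_ π → ∀ colour → ∃ λ ℓ → π ℓ ≡ colour
injective⇒onto {d} π π-inj colour with pigeonhole (n<1+n d) (colour ◂ π)
... | zero  , suc j , _   , colour≡πj = j , sym colour≡πj
... | suc i , suc j , i<j , πi≡πj = contradiction (cong suc (π-inj πi≡πj)) (<⇒≢ i<j)

first-of-two : ∀ {A : Set} {a b u : A} → u ∈ a ∷ b ∷ [] → u ≢ b → u ≡ a
first-of-two (here u≡a)         _   = u≡a
first-of-two (there (here u≡b)) u≢b = contradiction u≡b u≢b

second-of-two : ∀ {A : Set} {a b u : A} → u ∈ a ∷ b ∷ [] → u ≢ a → u ≡ b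
second-of-two (here u≡a)         u≢a = contradiction u≡a u≢a
second-of-two (there (here u≡b)) _   = u≡b

other-of-two : ∀ {A : Set} {a b u v : A} → u ∈ a ∷ b ∷ [] → v ∈ a ∷ b ∷ [] →
               u ≢ v → u ≢ a → v ≡ a
other-of-two u∈ v∈ u≢v u≢a =
  first-of-two v∈ λ v≡b → u≢v (trans (second-of-two u∈ u≢a) (sym v≡b))

posCol-onto : ∀ {u} → u ∈ col1 ∷ col2 ∷ col3 ∷ [] → ∃ λ p → u ≡ posCol p
posCol-onto (here u≡1)                 = zero , u≡1
posCol-onto (there (here u≡2))         = suc zero , u≡2
posCol-onto (there (there (here u≡3))) = suc (suc zero) , u≡3

posCol∈ : ∀ p → posCol p ∈ col1 ∷ col2 ∷ col3 ∷ []
posCol∈ zero             = here refl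
posCol∈ (suc zero)       = there (here refl)
posCol∈ (suc (suc zero)) = there (there (here refl))

posCol-injective : Injective _≡_ _≡_ posCol
posCol-injective {zero}           {zero}           _ = refl
posCol-injective {suc zero}       {suc zero}       _ = refl
posCol-injective {suc (suc zero)} {suc (suc zero)} _ = refl
posCol-injective {zero}           {suc zero}       ()
posCol-injective {zero}           {suc (suc zero)} ()
posCol-injective {suc zero}       {zero}           ()
posCol-injective {suc zero}       {suc (suc zero)} ()
posCol-injective {suc (suc zero)} {zero}           ()
posCol-injective {suc (suc zero)} {suc zero}       ()

posCol≢4 : ∀ p → posCol p ≢ col4
posCol≢4 zero             ()
posCol≢4 (suc zero)       ()
posCol≢4 (suc (suc zero)) ()

posCol≢5 : ∀ p → posCol p ≢ col5
posCol≢5 zero             ()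
posCol≢5 (suc zero)       ()
posCol≢5 (suc (suc zero)) ()

posCol-separates : ∀ (f : Fin 3 → Bool) {p q} → f p ≡ true → f q ≡ false → posCol p ≢ posCol q
posCol-separates f fp≡true fq≡false eq
  with () ← trans (sym fp≡true) (trans (cong f (posCol-injective eq)) fq≡false)

ListColouring : ∀ {n m} → Instance n m → (VG n m → Fin 5) → Set
ListColouring cl φ = (∀ u → φ u ∈ L u) × (∀ {u v} → EdgeG cl u v → φ u ≢ φ v)

ListColourable : ∀ {n m} → Instance n m → Set
ListColourable {n} {m} cl = Σ (VG n m → Fin 5) (ListColouring cl)

proper-undirected : ∀ {n m} {cl : Instance n m} (col : V' n m → Fin 5) →
                    (∀ {u v} → EdgeG' cl u v → col u ≢ col v) →
                    ∀ u v → Adj' cl u v → col u ≢ col v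
proper-undirected col proper u v (inj₁ e) = proper e
proper-undirected col proper u v (inj₂ e) = proper e ∘ sym

listColourable⇒fiveColourable : ∀ {n m} (cl : Instance n m) → ListColourable cl → FiveColourable cl
listColourable⇒fiveColourable {n} {m} cl (φ , φ∈L , φ-proper) = col , proper-undirected col proper
  where
  col : V' n m → Fin 5
  col (g u) = φ u
  col (k ℓ) = ℓ

  proper : ∀ {u v} → EdgeG' cl u v → col u ≢ col v
  proper (old e)         = φ-proper e
  proper (clique _ _ ne) = ne
  proper (k-u ℓ u ℓ∉L) ℓ≡φu = ℓ∉L (subst (_∈ L u) (sym ℓ≡φu) (φ∈L u))

-- Clique gadget, hard half: read colours through the bijection ℓ ↦ col (k ℓ).
fiveColourable⇒listColourable : ∀ {n m} (cl : Instance n m) → FiveColourable cl → ListColourable cl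
fiveColourable⇒listColourable {n} {m} cl (col , proper) = φ , φ∈L , φ-proper
  where
  π : Fin 5 → Fin 5
  π ℓ = col (k ℓ)

  π-injective : Injective _≡_ _≡_ π
  π-injective {ℓ} {ℓ'} πℓ≡πℓ' with ℓ ≟ ℓ'
  ... | yes ℓ≡ℓ' = ℓ≡ℓ'
  ... | no  ℓ≢ℓ' = contradiction πℓ≡πℓ' (proper (k ℓ) (k ℓ') (inj₁ (clique ℓ ℓ' ℓ≢ℓ')))

  φ : VG n m → Fin 5
  φ u = proj₁ (injective⇒onto π π-injective (col (g u)))

  πφ : ∀ u → π (φ u) ≡ col (g u)
  πφ u = proj₂ (injective⇒onto π π-injective (col (g u)))

  φ∈L : ∀ u → φ u ∈ L u
  φ∈L u with φ u ∈? L u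
  ... | yes φu∈L = φu∈L
  ... | no  φu∉L = contradiction (πφ u) (proper (k (φ u)) (g u) (inj₁ (k-u (φ u) u φu∉L)))

  φ-proper : ∀ {u v} → EdgeG cl u v → φ u ≢ φ v
  φ-proper {u} {v} e φu≡φv = proper (g u) (g v) (inj₁ (old e))
    (trans (sym (πφ u)) (trans (cong π φu≡φv) (πφ v)))

module FromAssignment {n m : ℕ} (cl : Instance n m) (τ : Fin n → Bool) (sat : NAESatisfies cl τ) where

  truePos falsePos : Fin m → Fin 3
  truePos  j = proj₁ (proj₁ (sat j))
  falsePos j = proj₁ (proj₂ (sat j))

  φ : VG n m → Fin 5
  φ (x i)    = if τ i then col4 else col5
  φ (x̄ i)    = if τ i then col5 else col4
  φ (c j)    = posCol (falsePos j)
  φ (c' j)   = posCol (truePos j)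
  φ (a j p)  = if τ (cl j p) then posCol p else col4
  φ (a' j p) = if τ (cl j p) then col4 else posCol p

  φ∈L : ∀ u → φ u ∈ L u
  φ∈L (x i)    with τ i
  ... | true  = here refl
  ... | false = there (here refl)
  φ∈L (x̄ i)    with τ i
  ... | true  = there (here refl)
  ... | false = here refl
  φ∈L (c j)    = posCol∈ (falsePos j)
  φ∈L (c' j)   = posCol∈ (truePos j)
  φ∈L (a j p)  with τ (cl j p)
  ... | true  = here refl
  ... | false = there (here refl)
  φ∈L (a' j p) with τ (cl j p)
  ... | true  = there (here refl)
  ... | false = here refl

  high≢posCol : ∀ b q → (if b then col4 else col5) ≢ posCol q × (if b then col5 else col4) ≢ posCol q
  high≢posCol true  q = posCol≢4 q ∘ sym , posCol≢5 q ∘ sym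
  high≢posCol false q = posCol≢5 q ∘ sym , posCol≢4 q ∘ sym

  truth : ∀ j → Fin 3 → Bool
  truth j p = τ (cl j p)

  φ-proper : ∀ {u v} → EdgeG cl u v → φ u ≢ φ v
  φ-proper (xx̄ i) with τ i
  ... | true  = λ ()
  ... | false = λ ()
  φ-proper (x-c i j)  = proj₁ (high≢posCol (τ i) (falsePos j))
  φ-proper (x-c' i j) = proj₁ (high≢posCol (τ i) (truePos j))
  φ-proper (x̄-c i j)  = proj₂ (high≢posCol (τ i) (falsePos j))
  φ-proper (x̄-c' i j) = proj₂ (high≢posCol (τ i) (truePos j))
  φ-proper (x-a j p) with τ (cl j p)
  ... | true  = posCol≢4 p ∘ sym
  ... | false = λ ()
  φ-proper (x̄-a' j p) with τ (cl j p)
  ... | true  = λ ()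
  ... | false = posCol≢4 p ∘ sym
  φ-proper (a-c j p) with τ (cl j p) in τp
  ... | true  = posCol-separates (truth j) τp (proj₂ (proj₂ (sat j)))
  ... | false = posCol≢4 (falsePos j) ∘ sym
  φ-proper (a'-c' j p) with τ (cl j p) in τp
  ... | true  = posCol≢4 (truePos j) ∘ sym
  ... | false = posCol-separates (truth j) (proj₂ (proj₁ (sat j))) τp ∘ sym

  listColourable : ListColourable cl
  listColourable = φ , φ∈L , φ-proper

module FromListColouring {n m : ℕ} (cl : Instance n m) (φ : VG n m → Fin 5)
                         (φ∈L : ∀ u → φ u ∈ L u) (φ-proper : ∀ {u v} → EdgeG cl u v → φ u ≢ φ v) where

  x̄-coloured-4 : ∀ i → φ (x i) ≢ col4 → φ (x̄ i) ≡ col4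
  x̄-coloured-4 i = other-of-two (φ∈L (x i)) (φ∈L (x̄ i)) (φ-proper (xx̄ i))

  x-coloured-4 : ∀ i → φ (x̄ i) ≢ col4 → φ (x i) ≡ col4
  x-coloured-4 i = other-of-two (φ∈L (x̄ i)) (φ∈L (x i)) (φ-proper (xx̄ i) ∘ sym)

  -- C_j sees the colours of its a-vertices; if all its x-vertices are coloured 4,
  -- these are 1, 2, 3 and C_j has no colour left.  Likewise for C'_j.
  not-all-x-4 : ∀ j → ¬ (∀ p → φ (x (cl j p)) ≡ col4)
  not-all-x-4 j all-4 with posCol-onto (φ∈L (c j))
  ... | p , φc≡p = φ-proper (a-c j p) (trans φa≡p (sym φc≡p))
    where
    φa≡p : φ (a j p) ≡ posCol p
    φa≡p = first-of-two (φ∈L (a j p)) (φ-proper (x-a j p) ∘ trans (all-4 p) ∘ sym)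

  not-all-x̄-4 : ∀ j → ¬ (∀ p → φ (x̄ (cl j p)) ≡ col4)
  not-all-x̄-4 j all-4 with posCol-onto (φ∈L (c' j))
  ... | p , φc'≡p = φ-proper (a'-c' j p) (trans φa'≡p (sym φc'≡p))
    where
    φa'≡p : φ (a' j p) ≡ posCol p
    φa'≡p = first-of-two (φ∈L (a' j p)) (φ-proper (x̄-a' j p) ∘ trans (all-4 p) ∘ sym)

  τ : Fin n → Bool
  τ i = does (φ (x i) ≟ col4)

  satisfies : NAESatisfies cl τ
  satisfies j = has-true , has-false
    where
    has-true : ∃ λ p → τ (cl j p) ≡ true
    has-true with ¬∀⟶∃¬ 3 (λ p → φ (x̄ (cl j p)) ≡ col4) (λ p → φ (x̄ (cl j p)) ≟ col4) (not-all-x̄-4 j)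
    ... | p , x̄≢4 = p , dec-true (φ (x (cl j p)) ≟ col4) (x-coloured-4 (cl j p) x̄≢4)

    has-false : ∃ λ p → τ (cl j p) ≡ false
    has-false with ¬∀⟶∃¬ 3 (λ p → φ (x (cl j p)) ≡ col4) (λ p → φ (x (cl j p)) ≟ col4) (not-all-x-4 j)
    ... | p , x≢4 = p , dec-false (φ (x (cl j p)) ≟ col4) x≢4

-- The reduction does not need the three variables of a clause to be distinct.
lemma8 : ∀ (n m : ℕ) (cl : Instance n m) → ProperInstance cl →
           NAESatisfiable cl ⇔ FiveColourable cl
lemma8 n m cl _ = mk⇔ satisfiable⇒colourable colourable⇒satisfiable
  where
  satisfiable⇒colourable : NAESatisfiable cl → FiveColourable cl
  satisfiable⇒colourable (τ , sat) =
    listColourable⇒fiveColourable cl (FromAssignment.listColourable cl τ sat)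

  colourable⇒satisfiable : FiveColourable cl → NAESatisfiable cl
  colourable⇒satisfiable colourable with fiveColourable⇒listColourable cl colourable
  ... | φ , φ∈L , φ-proper = FromListColouring.τ cl φ φ∈L φ-proper
                           , FromListColouring.satisfies cl φ φ∈L φ-proper
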